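{- For any (finite) graph $G = (V,E)$, $$\hat{b}(G) \le b(G) \le 2\hat{b}(G).$$
   Context: For $r \in \mathbb{N}_0$ and $v \in V$, $B_r(v) = \{u \in V : d(u,v) \le r\}$, where $d$ is graph distance. The burning number is $b(G) = \min\{k \in \mathbb{N} : \exists v_0, v_1, \dots, v_{k-1} \in V \text{ such that } \bigcup_{r=0}^{k-1} B_r(v_r) = V\}$ (equivalently, the minimum number of rounds of the burning process, in which each round every burning vertex ignites its neighbours and one new fire source is chosen). The auxiliary quantity is $\hat{b}(G) = \min\{k \in \mathbb{N} : \exists v_1, \dots, v_k \in V \text{ such that } \bigcup_{r=1}^{k} B_k(v_r) = V\}$, i.e. the least $k$ such that $V$ is covered by $k$ balls each of radius $k$. -}

module Defs where

open import Data.Nat using (ℕ; zero; suc; _≤_)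
open import Data.Fin using (Fin; toℕ)
open import Data.Product using (Σ; _×_; ∃-syntax)
open import Relation.Nullary using (¬_)

record Graph (n : ℕ) : Set₁ where
  field
    Adj     : Fin n → Fin n → Set
    sym     : ∀ {u v} → Adj u v → Adj v u
    irrefl  : ∀ {v} → ¬ Adj v v
open Graph public

data Walk {n : ℕ} (G : Graph n) : ℕ → Fin n → Fin n → Set where
  here : ∀ {v} → Walk G zero v v
  step : ∀ {k u w v} → Adj G u w → Walk G k w v → Walk G (suc k) u v

-- d(u , v) ≤ r   (graph distance; ∞ if disconnected)
DistLE : ∀ {n} → Graph n → Fin n → Fin n → ℕ → Set
DistLE G u v r = ∃[ k ] (k ≤ r × Walk G k u v)

InBall : ∀ {n} → Graph n → ℕ → Fin n → Fin n → Set
InBall G r v u = DistLE G u v r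

Burns : ∀ {n} → Graph n → ℕ → Set
Burns {n} G k = Σ (Fin k → Fin n) λ v → (u : Fin n) → Σ (Fin k) λ r → InBall G (toℕ r) (v r) u

HatCovers : ∀ {n} → Graph n → ℕ → Set
HatCovers {n} G k = Σ (Fin k → Fin n) λ v → (u : Fin n) → ∃[ i ] InBall G k (v i) u

IsMin : (ℕ → Set) → ℕ → Set
IsMin P m = 1 ≤ m × P m × (∀ k → 1 ≤ k → P k → m ≤ k)

IsBurningNumber : ∀ {n} → Graph n → ℕ → Set
IsBurningNumber G = IsMin (Burns G)

IsHatBurningNumber : ∀ {n} → Graph n → ℕ → Set
IsHatBurningNumber G = IsMin (HatCovers G)

{-# OPTIONS --safe #-}
module Submission where

-- A burning sequence of length k covers V by k balls of radius at most k − 1 < k.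
-- Conversely, if k balls of radius k cover V, use their centres as the sources of radii
-- k, …, 2k − 1 of a burning sequence of length 2k; the sources of smaller radius are
-- irrelevant and just repeat the centres, so no extra vertex is needed when k = 0.

open import Defs hiding (sym)
open import Data.Nat using (ℕ; _≤_; _*_; _+_)
open import Data.Nat.Properties using (≤-trans; ≤-reflexive; <⇒≤; m≤m+n; m≤n⇒m≤o*n; +-identityʳ)
open import Data.Fin using (Fin; toℕ; splitAt; _↑ʳ_)
open import Data.Fin.Properties using (toℕ<n; toℕ-↑ʳ; splitAt-↑ʳ)
open import Data.Product using (_×_; _,_; Σ)
open import Data.Sum using ([_,_])
open import Function using (_∘_)
open import Relation.Binary.PropositionalEquality using (_≡_; sym; cong; subst)

InBall-mono : ∀ {n} (G : Graph n) {r s v u} → r ≤ s → InBall G r v u → InBall G s v u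
InBall-mono G r≤s (k , k≤r , walk) = k , ≤-trans k≤r r≤s , walk

Burns⇒HatCovers : ∀ {n} (G : Graph n) {k} → Burns G k → HatCovers G k
Burns⇒HatCovers {n} G {k} (v , burnt) = v , covered
  where
  covered : ∀ u → Σ (Fin k) λ r → InBall G k (v r) u
  covered u with burnt u
  ... | r , u∈B = r , InBall-mono G (<⇒≤ (toℕ<n r)) u∈B

HatCovers⇒Burns : ∀ {n} (G : Graph n) k → HatCovers G k → Burns G (k + k)
HatCovers⇒Burns {n} G k (v , cover) = source , burnt
  where
  source : Fin (k + k) → Fin n
  source = [ v , v ] ∘ splitAt k

  source-↑ʳ : ∀ i → source (k ↑ʳ i) ≡ v i
  source-↑ʳ i = cong [ v , v ] (splitAt-↑ʳ k k i)

  k≤toℕ-↑ʳ : ∀ (i : Fin k) → k ≤ toℕ (k ↑ʳ i)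
  k≤toℕ-↑ʳ i = ≤-trans (m≤m+n k (toℕ i)) (≤-reflexive (sym (toℕ-↑ʳ k i)))

  burnt : ∀ u → Σ (Fin (k + k)) λ r → InBall G (toℕ r) (source r) u
  burnt u with cover u
  ... | i , u∈B = k ↑ʳ i , subst (λ c → InBall G _ c u) (sym (source-↑ʳ i)) (InBall-mono G (k≤toℕ-↑ʳ i) u∈B)

mainTheorem2 : (n : ℕ) (G : Graph n) (b bh : ℕ) → IsBurningNumber G b → IsHatBurningNumber G bh → bh ≤ b × b ≤ 2 * bh
mainTheorem2 n G b bh (1≤b , burns-b , b-min) (1≤bh , covers-bh , bh-min) =
  bh-min b 1≤b (Burns⇒HatCovers G burns-b) ,
  b-min (2 * bh) (m≤n⇒m≤o*n 2 1≤bh) burns-2bh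
  where
  burns-2bh : Burns G (2 * bh)
  burns-2bh = subst (Burns G) (cong (bh +_) (sym (+-identityʳ bh))) (HatCovers⇒Burns G bh covers-bh)
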